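{- For any finite posets $P$ and $Q$, $RR(P,Q)\le RR(B_{\dim_2(P)},B_{\dim_2(Q)})$.
   Context: For a positive integer $N$, $\mathcal{B}_N$ denotes the Boolean lattice of all subsets of $[N]=\{1,\dots,N\}$ ordered by inclusion. A family $\mathcal{G}$ of sets is a copy of a poset $P$ if there is a bijection $\phi:P\to\mathcal{G}$ with $x<_P y$ if and only if $\phi(x)\subsetneq\phi(y)$; a family contains $P$ if it has a subfamily that is a copy of $P$. A coloring of $\mathcal{B}_N$ is any map from $\mathcal{B}_N$ to the positive integers. Under a coloring, a monochromatic $P$ is a copy of $P$ all of whose sets have the same color, and a rainbow $Q$ is a copy of $Q$ whose sets have pairwise distinct colors. $RR(P,Q)$ is the minimum integer $N$ such that every coloring of $\mathcal{B}_N$ contains a monochromatic $P$ or a rainbow $Q$. $B_k$ denotes the poset isomorphic to $\mathcal{B}_k$. The 2-dimension $\dim_2(P)$ is the minimum $n$ such that $\mathcal{B}_n$ contains $P$. -}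

module Defs where

open import Data.Nat using (ℕ; _<_; _≤_)
open import Data.Fin using (Fin)
open import Data.Fin.Subset using (Subset; _⊂_)
open import Data.Product using (Σ; ∃; _×_; _,_)
open import Relation.Binary.PropositionalEquality using (_≡_)
open import Relation.Nullary using (¬_)
open import Function using (_∘_)
open import Function.Definitions using (Injective)

-- A (strict) poset is given by a carrier A and a strict order _≺_ on A.
-- Finite posets are taken with carrier Fin n (hypothesis IsStrictPartialOrder
-- is imposed in the statement).

record Copy {A : Set} (_≺_ : A → A → Set) (N : ℕ) : Set where
  field
    φ      : A → Subset N
    φ-inj  : Injective _≡_ _≡_ φ
    φ-mono : ∀ x y → x ≺ y → φ x ⊂ φ y
    φ-refl : ∀ x y → φ x ⊂ φ y → x ≺ y
open Copy public

-- A coloring of B_N (colors in ℕ; the name of the color set is irrelevant).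
Coloring : ℕ → Set
Coloring N = Subset N → ℕ

MonoCopy : {A : Set} (_≺_ : A → A → Set) (N : ℕ) → Coloring N → Set
MonoCopy _≺_ N c = Σ (Copy _≺_ N) λ C → ∃ λ k → ∀ x → c (φ C x) ≡ k

RainbowCopy : {A : Set} (_≺_ : A → A → Set) (N : ℕ) → Coloring N → Set
RainbowCopy _≺_ N c = Σ (Copy _≺_ N) λ C → Injective _≡_ _≡_ (c ∘ φ C)

RamseyProp : {A B : Set} (_≺P_ : A → A → Set) (_≺Q_ : B → B → Set) → ℕ → Set
RamseyProp _≺P_ _≺Q_ N =
  (c : Coloring N) → (MonoCopy _≺P_ N c) Data.Sum.⊎ (RainbowCopy _≺Q_ N c)
  where import Data.Sum

IsRR : {A B : Set} (_≺P_ : A → A → Set) (_≺Q_ : B → B → Set) → ℕ → Set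
IsRR _≺P_ _≺Q_ N =
  RamseyProp _≺P_ _≺Q_ N × (∀ M → M < N → ¬ RamseyProp _≺P_ _≺Q_ M)

IsDim2 : {A : Set} (_≺_ : A → A → Set) → ℕ → Set
IsDim2 _≺_ n = Copy _≺_ n × (∀ m → m < n → ¬ Copy _≺_ m)

B : (k : ℕ) → Subset k → Subset k → Set
B k = _⊂_

{-# OPTIONS --safe #-}
-- Composing an embedding P ↪ B_a with a monochromatic copy of B_a gives a monochromatic
-- copy of P, and an embedding Q ↪ B_b turns a rainbow copy of B_b into a rainbow copy of Q;
-- so every coloring of B_N with N = RR(B_a, B_b) already contains a monochromatic P or a
-- rainbow Q. The least such N exists constructively because the property is decidable:
-- copies in B_N are among finitely many maps, and a coloring matters only through its
-- kernel, so it suffices to check the finitely many colorings by elements of B_N.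

module Submission where

open import Defs
open import Level using (0ℓ)
open import Data.Nat using (ℕ; zero; suc; _≤_; _<_)
open import Data.Nat.Binary using (ℕᵇ; zero; 2[1+_]; 1+[2_])
import Data.Nat.Binary as ℕᵇ
open import Data.Nat.Binary.Properties using (2[1+_]-injective; 1+[2_]-injective; toℕ-injective)
open import Data.Nat.Properties using (_≟_)
open import Data.Fin using (Fin; zero; suc; toℕ; fromℕ; fromℕ<)
import Data.Fin.Properties as Fin
open import Data.Fin.Properties
  using (all?; ¬∀⟶∃¬-smallest; toℕ≤pred[n]; toℕ-fromℕ; toℕ-fromℕ<; toℕ-inject)
open import Data.Fin.Subset using (Subset; _⊂_; inside; outside)
import Data.Fin.Subset as Subset
open import Data.Fin.Subset.Properties using (_⊂?_; anySubset?)
open import Data.Vec using ([]; _∷_)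
import Data.Vec.Functional as Vector
open import Data.Vec.Properties using (≡-dec)
import Data.Bool.Properties as Bool
open import Data.Product using (Σ; ∃; _×_; _,_; proj₁; proj₂)
open import Data.Sum using (_⊎_)
import Data.Sum as Sum
open import Data.Empty using (⊥-elim)
open import Function using (_∘_; const)
open import Function.Definitions using (Injective)
open import Relation.Binary.PropositionalEquality using (_≡_; refl; sym; trans; cong; subst; subst₂; _≗_; module ≡-Reasoning)
open import Relation.Binary.Structures using (IsStrictPartialOrder)
open import Relation.Binary.Definitions using () renaming (Decidable to Decidable₂)
open import Relation.Nullary using (¬_; Dec; yes; no)
open import Relation.Nullary.Decidable using (map′; ¬?; _×-dec_; _⊎-dec_; _→-dec_; decidable-stable)
open import Relation.Unary using (Pred; Decidable)

Searchable : Set → Set₁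
Searchable X = ∀ {P : Pred X 0ℓ} → Decidable P → Dec (∃ P)

Extensional : {A X : Set} → Pred (A → X) 0ℓ → Set
Extensional P = ∀ {f g} → f ≗ g → P f → P g

ExtSearchable : Set → Set → Set₁
ExtSearchable A X = ∀ {P : Pred (A → X) 0ℓ} → Extensional P → Decidable P → Dec (∃ P)

Fin→-extSearchable : ∀ {X} → Searchable X → ∀ p → ExtSearchable (Fin p) X
Fin→-extSearchable search zero ext P? =
  map′ (λ Pf → _ , Pf) (λ (f , Pf) → ext (λ ()) Pf) (P? (λ ()))
Fin→-extSearchable search (suc p) {P} ext P? =
  map′ (λ (x , t , Pxt) → x Vector.∷ t , Pxt)
       (λ (f , Pf) → Vector.head f , Vector.tail f , ext η Pf)
       (search λ x → Fin→-extSearchable search p (ext ∘ ∷-cong x) (P? ∘ (x Vector.∷_)))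
  where
  η : ∀ {f : Fin (suc p) → _} i → f i ≡ (Vector.head f Vector.∷ Vector.tail f) i
  η zero    = refl
  η (suc i) = refl
  ∷-cong : ∀ x {t t′} → t ≗ t′ → ∀ i → (x Vector.∷ t) i ≡ (x Vector.∷ t′) i
  ∷-cong x e zero    = refl
  ∷-cong x e (suc i) = e i

headCases : ∀ {X : Set} {n} → (Subset n → X) → (Subset n → X) → Subset (suc n) → X
headCases g h (inside  ∷ s) = g s
headCases g h (outside ∷ s) = h s

Subset→-extSearchable : ∀ {X} → Searchable X → ∀ n → ExtSearchable (Subset n) X
Subset→-extSearchable search zero ext P? =
  map′ (λ (x , Px) → const x , Px) (λ (f , Pf) → f [] , ext (λ { [] → refl }) Pf)
       (search (P? ∘ const))
Subset→-extSearchable search (suc n) ext P? =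
  map′ (λ (g , h , Pgh) → headCases g h , Pgh)
       (λ (f , Pf) → f ∘ (inside ∷_) , f ∘ (outside ∷_) , ext η Pf)
       (Subset→-extSearchable search n
         (λ e (h , Pgh) → h , ext (λ { (inside ∷ s) → e s ; (outside ∷ s) → refl }) Pgh)
         (λ g → Subset→-extSearchable search n
           (ext ∘ λ e → λ { (inside ∷ s) → refl ; (outside ∷ s) → e s })
           (P? ∘ headCases g)))
  where
  η : ∀ {f : Subset (suc n) → _} s → f s ≡ headCases (f ∘ (inside ∷_)) (f ∘ (outside ∷_)) s
  η (inside  ∷ s) = refl
  η (outside ∷ s) = refl

smallest : {R : Pred ℕ 0ℓ} → Decidable R → ∀ {n} → R n → ∃ λ m → m ≤ n × R m × (∀ k → k < m → ¬ R k)
smallest {R} R? {n} Rn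
  with ¬∀⟶∃¬-smallest (suc n) (¬_ ∘ R ∘ toℕ) (¬? ∘ R? ∘ toℕ)
         (λ ¬R → ¬R (fromℕ n) (subst R (sym (toℕ-fromℕ n)) Rn))
... | i , ¬¬Ri , ¬R<i = toℕ i , toℕ≤pred[n] i , decidable-stable (R? (toℕ i)) ¬¬Ri , below
  where
  below : ∀ k → k < toℕ i → ¬ R k
  below k k<i = subst (¬_ ∘ R) (trans (toℕ-inject (fromℕ< k<i)) (toℕ-fromℕ< k<i)) (¬R<i (fromℕ< k<i))

toℕᵇ : ∀ {n} → Subset n → ℕᵇ
toℕᵇ []            = zero
toℕᵇ (outside ∷ s) = 2[1+ toℕᵇ s ]
toℕᵇ (inside  ∷ s) = 1+[2 toℕᵇ s ]

toℕᵇ-injective : ∀ {n} → Injective _≡_ _≡_ (toℕᵇ {n})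
toℕᵇ-injective {x = []}          {[]}          _ = refl
toℕᵇ-injective {x = outside ∷ s} {outside ∷ t} e = cong (outside ∷_) (toℕᵇ-injective (2[1+_]-injective e))
toℕᵇ-injective {x = inside  ∷ s} {inside  ∷ t} e = cong (inside ∷_) (toℕᵇ-injective (1+[2_]-injective e))
toℕᵇ-injective {x = outside ∷ s} {inside  ∷ t} ()
toℕᵇ-injective {x = inside  ∷ s} {outside ∷ t} ()

subsetCode : ∀ {n} → Subset n → ℕ
subsetCode = ℕᵇ.toℕ ∘ toℕᵇ

subsetCode-injective : ∀ {n} → Injective _≡_ _≡_ (subsetCode {n})
subsetCode-injective = toℕᵇ-injective ∘ toℕ-injective

PairwiseOn : {A X : Set} → (A → A → X → X → Set) → Pred (A → X) 0ℓ
PairwiseOn R f = ∀ x y → R x y (f x) (f y)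

pairwiseOn-extensional : ∀ {A X : Set} (R : A → A → X → X → Set) → Extensional (PairwiseOn R)
pairwiseOn-extensional R e Rf x y = subst₂ (R x y) (e x) (e y) (Rf x y)

pairwiseOn? : ∀ {p} {X : Set} {R : Fin p → Fin p → X → X → Set} →
              (∀ x y u v → Dec (R x y u v)) → Decidable (PairwiseOn R)
pairwiseOn? R? f = all? λ x → all? λ y → R? x y (f x) (f y)

pairwise≡⇒constant : ∀ {p} (f : Fin p → ℕ) → (∀ x y → f x ≡ f y) → ∃ λ k → ∀ x → f x ≡ k
pairwise≡⇒constant {zero}  f h = 0 , λ ()
pairwise≡⇒constant {suc p} f h = f zero , λ x → h x zero

module _ {p} {_≺_ : Fin p → Fin p → Set} (_≺?_ : Decidable₂ _≺_) {N : ℕ} where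

  CopyAt : Fin p → Fin p → Subset N → Subset N → Set
  CopyAt x y u v = (u ≡ v → x ≡ y) × (x ≺ y → u ⊂ v) × (u ⊂ v → x ≺ y)

  copyAt? : ∀ x y u v → Dec (CopyAt x y u v)
  copyAt? x y u v =
    (≡-dec Bool._≟_ u v →-dec (x Fin.≟ y)) ×-dec ((x ≺? y) →-dec (u ⊂? v)) ×-dec ((u ⊂? v) →-dec (x ≺? y))

  copyWith? : {R : Fin p → Fin p → Subset N → Subset N → Set} → (∀ x y u v → Dec (R x y u v)) →
              Dec (Σ (Copy _≺_ N) λ C → PairwiseOn R (φ C))
  copyWith? {R} R? =
    map′ fromPairwise toPairwise
      (Fin→-extSearchable anySubset? p (pairwiseOn-extensional CopyAtWith)
        (pairwiseOn? λ x y u v → copyAt? x y u v ×-dec R? x y u v))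
    where
    CopyAtWith : Fin p → Fin p → Subset N → Subset N → Set
    CopyAtWith x y u v = CopyAt x y u v × R x y u v

    fromPairwise : ∃ (PairwiseOn CopyAtWith) → Σ (Copy _≺_ N) λ C → PairwiseOn R (φ C)
    fromPairwise (f , h) =
      record { φ      = f
             ; φ-inj  = λ {x y} → proj₁ (proj₁ (h x y))
             ; φ-mono = λ x y → proj₁ (proj₂ (proj₁ (h x y)))
             ; φ-refl = λ x y → proj₂ (proj₂ (proj₁ (h x y))) }
      , λ x y → proj₂ (h x y)

    toPairwise : (Σ (Copy _≺_ N) λ C → PairwiseOn R (φ C)) → ∃ (PairwiseOn CopyAtWith)
    toPairwise (C , h) = φ C , λ x y → (φ-inj C , φ-mono C x y , φ-refl C x y) , h x y

  monoCopy? : (c : Coloring N) → Dec (MonoCopy _≺_ N c)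
  monoCopy? c =
    map′ (λ (C , h) → C , pairwise≡⇒constant (c ∘ φ C) h)
         (λ (C , k , h) → C , λ x y → trans (h x) (sym (h y)))
         (copyWith? λ _ _ u v → c u ≟ c v)

  rainbowCopy? : (c : Coloring N) → Dec (RainbowCopy _≺_ N c)
  rainbowCopy? c =
    map′ (λ (C , h) → C , λ {x y} → h x y) (λ (C , h) → C , λ x y → h)
         (copyWith? λ x y u v → (c u ≟ c v) →-dec (x Fin.≟ y))

copy⇒decidable : ∀ {A : Set} {_≺_ : A → A → Set} {n} → Copy _≺_ n → Decidable₂ _≺_
copy⇒decidable C x y = map′ (φ-refl C x y) (φ-mono C x y) (φ C x ⊂? φ C y)

FactorsThrough : ∀ {N} → Coloring N → Coloring N → Set
FactorsThrough c′ c = ∀ s t → c s ≡ c t → c′ s ≡ c′ t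

module _ {p} {_≺_ : Fin p → Fin p → Set} {N : ℕ} {c c′ : Coloring N} where

  monoCopy-transfer : FactorsThrough c′ c → MonoCopy _≺_ N c → MonoCopy _≺_ N c′
  monoCopy-transfer c′∘c (C , k , h) =
    C , pairwise≡⇒constant (c′ ∘ φ C) λ x y → c′∘c _ _ (trans (h x) (sym (h y)))

  rainbowCopy-transfer : FactorsThrough c c′ → RainbowCopy _≺_ N c → RainbowCopy _≺_ N c′
  rainbowCopy-transfer c∘c′ (C , h) = C , λ e → h (c∘c′ _ _ e)

module _ {N : ℕ} (c : Coloring N) where

  representative : ℕ → Subset N
  representative k with anySubset? (λ s → c s ≟ k)
  ... | yes (s , _) = s
  ... | no _        = Subset.⊥

  representative-colour : ∀ s → c (representative (c s)) ≡ c s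
  representative-colour s with anySubset? (λ t → c t ≟ c s)
  ... | yes (_ , cs≡ct) = cs≡ct
  ... | no ∄t           = ⊥-elim (∄t (s , refl))

  compress : Coloring N
  compress = subsetCode ∘ representative ∘ c

  compress-factorsThrough : FactorsThrough compress c
  compress-factorsThrough _ _ = cong (subsetCode ∘ representative)

  factorsThrough-compress : FactorsThrough c compress
  factorsThrough-compress s t e = begin
    c s                        ≡⟨ representative-colour s ⟨
    c (representative (c s))   ≡⟨ cong c (subsetCode-injective e) ⟩
    c (representative (c t))   ≡⟨ representative-colour t ⟩
    c t                        ∎
    where open ≡-Reasoning

≗⇒factorsThrough : ∀ {N} {c c′ : Coloring N} → c ≗ c′ → FactorsThrough c c′
≗⇒factorsThrough c≗c′ s t e = trans (c≗c′ s) (trans e (sym (c≗c′ t)))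

module _ {p q} {_≺P_ : Fin p → Fin p → Set} {_≺Q_ : Fin q → Fin q → Set}
         (_≺P?_ : Decidable₂ _≺P_) (_≺Q?_ : Decidable₂ _≺Q_) (N : ℕ) where

  MonoOrRainbow : Pred (Coloring N) 0ℓ
  MonoOrRainbow c = MonoCopy _≺P_ N c ⊎ RainbowCopy _≺Q_ N c

  monoOrRainbow? : Decidable MonoOrRainbow
  monoOrRainbow? c = monoCopy? _≺P?_ c ⊎-dec rainbowCopy? _≺Q?_ c

  monoOrRainbow-transfer : ∀ {c c′} → FactorsThrough c′ c → FactorsThrough c c′ →
                           MonoOrRainbow c → MonoOrRainbow c′
  monoOrRainbow-transfer c′∘c c∘c′ = Sum.map (monoCopy-transfer c′∘c) (rainbowCopy-transfer c∘c′)

  counterexampleOnSubsets? : Dec (∃ λ (g : Subset N → Subset N) → ¬ MonoOrRainbow (subsetCode ∘ g))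
  counterexampleOnSubsets? =
    Subset→-extSearchable anySubset? N
      (λ g≗g′ ¬mr mr → ¬mr (monoOrRainbow-transfer (recode g≗g′) (recode (sym ∘ g≗g′)) mr))
      (λ g → ¬? (monoOrRainbow? (subsetCode ∘ g)))
    where
    recode : ∀ {g g′ : Subset N → Subset N} → g ≗ g′ → FactorsThrough (subsetCode ∘ g) (subsetCode ∘ g′)
    recode g≗g′ = ≗⇒factorsThrough (cong subsetCode ∘ g≗g′)

  ramseyProp? : Dec (RamseyProp _≺P_ _≺Q_ N)
  ramseyProp? with counterexampleOnSubsets?
  ... | yes (g , ¬mr) = no λ ramsey → ¬mr (ramsey (subsetCode ∘ g))
  ... | no ∄g = yes λ c →
    monoOrRainbow-transfer (factorsThrough-compress c) (compress-factorsThrough c)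
      (decidable-stable (monoOrRainbow? (compress c)) λ ¬mr → ∄g (representative c ∘ c , ¬mr))

Copy-∘ : ∀ {A : Set} {_≺_ : A → A → Set} {a N} → Copy (B a) N → Copy _≺_ a → Copy _≺_ N
Copy-∘ C D = record
  { φ      = φ C ∘ φ D
  ; φ-inj  = φ-inj D ∘ φ-inj C
  ; φ-mono = λ x y → φ-mono C _ _ ∘ φ-mono D x y
  ; φ-refl = λ x y → φ-refl D x y ∘ φ-refl C _ _
  }

ramseyProp-embed : ∀ {A A′ : Set} {_≺P_ : A → A → Set} {_≺Q_ : A′ → A′ → Set} {a b N} →
                   Copy _≺P_ a → Copy _≺Q_ b → RamseyProp (B a) (B b) N → RamseyProp _≺P_ _≺Q_ N
ramseyProp-embed P↪Ba Q↪Bb ramsey c =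
  Sum.map (λ (C , k , h) → Copy-∘ C P↪Ba , k , h ∘ φ P↪Ba)
          (λ (C , h) → Copy-∘ C Q↪Bb , λ e → φ-inj Q↪Bb (h e))
          (ramsey c)

mainTheorem10 : (p q : ℕ) (_≺P_ : Fin p → Fin p → Set) (_≺Q_ : Fin q → Fin q → Set)
    → IsStrictPartialOrder _≡_ _≺P_ → IsStrictPartialOrder _≡_ _≺Q_
    → (a b : ℕ) → IsDim2 _≺P_ a → IsDim2 _≺Q_ b
    → (N : ℕ) → IsRR (B a) (B b) N
    → ∃ λ M → IsRR _≺P_ _≺Q_ M × M ≤ N
mainTheorem10 p q _≺P_ _≺Q_ _ _ a b (P↪Ba , _) (Q↪Bb , _) N (ramsey , _) =
  let M , M≤N , ramseyM , ¬ramsey<M =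
        smallest (ramseyProp? (copy⇒decidable P↪Ba) (copy⇒decidable Q↪Bb))
                 (ramseyProp-embed P↪Ba Q↪Bb ramsey)
  in M , (ramseyM , ¬ramsey<M) , M≤N
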